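{- Let $m\ge 3$ and $n\ge m+1$ (so that $\{2,m\}$ is admissible). Then $$\#PV(2,m;n)=\binom{n-2}{m-2}+(m-2)\binom{n-1}{m-1}.$$
   Context: For a permutation $\pi=a_1\ldots a_n$ of $\{1,\ldots,n\}$, an index $i$ is a peak if $a_{i-1}<a_i>a_{i+1}$ and a valley if $a_{i-1}>a_i<a_{i+1}$. $PV(\pi)$ is the set of all peaks and valleys of $\pi$. For $i_1<\cdots<i_s$, $PV(i_1,\ldots,i_s;n)$ is the set of permutations $\pi$ of $\{1,\ldots,n\}$ with $PV(\pi)=\{i_1,\ldots,i_s\}$ and $i_1$ a peak of $\pi$ (peaks and valleys then alternate). -}

module Defs where

open import Data.Nat using (ℕ; zero; suc; _+_; _<_; _≡ᵇ_; _<ᵇ_)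
open import Data.Bool using (Bool; true; false; _∧_; _∨_; not; if_then_else_)
open import Data.List using (List; []; _∷_; map; concatMap; filter; length; upTo; lookup)
open import Data.Product using (_×_; _,_)
open import Relation.Binary.PropositionalEquality using (_≡_)
open import Relation.Nullary using (Dec)
open import Data.Bool.Properties using () renaming (_≟_ to _≟B_)

-- A permutation π = a₁ … aₙ of {1,…,n} is represented as the list [a₁, …, aₙ].

insertions : ℕ → List ℕ → List (List ℕ)
insertions x [] = (x ∷ []) ∷ []
insertions x (y ∷ ys) = (x ∷ y ∷ ys) ∷ map (y ∷_) (insertions x ys)

-- all permutations of a list (each exactly once when the entries are distinct)
perms : List ℕ → List (List ℕ)
perms [] = [] ∷ []
perms (x ∷ xs) = concatMap (insertions x) (perms xs)

oneTo : ℕ → List ℕ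
oneTo n = map suc (upTo n)

Perms : ℕ → List (List ℕ)
Perms n = perms (oneTo n)

-- 1-indexed entry a_i (with default 0 outside the range 1..n)
entry : List ℕ → ℕ → ℕ
entry [] _ = 0
entry (x ∷ xs) zero = 0
entry (x ∷ xs) (suc zero) = x
entry (x ∷ xs) (suc (suc i)) = entry xs (suc i)

isPeak : List ℕ → ℕ → Bool
isPeak π (suc (suc i)) =
  ((suc (suc i)) <ᵇ length π) ∧ (entry π (suc i) <ᵇ entry π (suc (suc i)))
                              ∧ (entry π (suc (suc (suc i))) <ᵇ entry π (suc (suc i)))
isPeak π _ = false

isValley : List ℕ → ℕ → Bool
isValley π (suc (suc i)) =
  ((suc (suc i)) <ᵇ length π) ∧ (entry π (suc (suc i)) <ᵇ entry π (suc i))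
                              ∧ (entry π (suc (suc i)) <ᵇ entry π (suc (suc (suc i))))
isValley π _ = false

isPV : List ℕ → ℕ → Bool
isPV π i = isPeak π i ∨ isValley π i

allBelow : ℕ → (ℕ → Bool) → Bool
allBelow zero f = true
allBelow (suc k) f = allBelow k f ∧ f k

-- π ∈ PV(2, m; n): PV(π) = {2, m} (as subsets of positions 1..n) and 2 is a peak
inPV2m : ℕ → List ℕ → Bool
inPV2m m π =
  isPeak π 2 ∧ allBelow (suc (length π)) (λ i → isPV π i ≡ᵇB ((i ≡ᵇ 2) ∨ (i ≡ᵇ m)))
  where
    _≡ᵇB_ : Bool → Bool → Bool
    true ≡ᵇB b = b
    false ≡ᵇB b = not b

countPV2m : ℕ → ℕ → ℕ
countPV2m m n = length (filter (λ π → inPV2m m π ≟B true) (Perms n))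

module Submission where

-- The up-down word of a permutation a₁ … aₙ has k-th letter `true` iff a_k < a_{k+1}.
-- Since adjacent entries differ, the peaks and valleys of π are exactly the places where
-- its word changes letter; as a word is determined by its first letter and its letter
-- changes, π ∈ PV(2, m; n) iff its word is U D^(m-2) U^(n-m) (one ascent, m-2 descents,
-- then ascents).  So #PV(2, m; n) counts the permutations with this word.
--
-- Such counts are computed by removing the minimum: the permutations of x ∷ xs (x below
-- xs) arise exactly once by inserting x into a permutation of xs, and the words arising
-- depend only on the word of that permutation (`weight-insertMin`).  Tracking where the
-- minimum of D^a U^b and of U D^a U^b can sit gives Pascal-type recurrences, whose
-- solutions are  #D^a U^b = C(a+b, a)  and  #U D^a U^b = C(a+b, a) + a·C(a+b+1, a+1);
-- the theorem is the second formula for a = m-2, b = n-m.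

open import Defs
open import Data.Nat using (ℕ; zero; suc; _+_; _*_; _∸_; _≤_; _<_; z≤n; s≤s; s≤s⁻¹; z<s; _<ᵇ_; _≡ᵇ_)
open import Data.Nat.Properties
open import Data.Nat.Combinatorics using (_C_; nCn≡1; nCk+nC[k+1]≡[n+1]C[k+1])
open import Data.Nat.ListAction using (sum)
open import Data.Nat.ListAction.Properties using (sum-++)
open import Data.Nat.Solver using (module +-*-Solver)
open import Algebra.Properties.CommutativeSemigroup +-commutativeSemigroup using (interchange)
open import Data.Bool using (Bool; true; false; _∧_; _∨_; not; _xor_; if_then_else_)
open import Data.Bool.Properties using (not-injective) renaming (_≟_ to _≟B_)
open import Data.List using (List; []; _∷_; _++_; map; concatMap; filter; length; replicate; upTo)
open import Data.List.Properties using (map-++; map-∘; map-cong; map-cong-local; length-map; length-upTo; length-replicate)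
open import Data.List.Membership.Propositional using (_∈_; find)
open import Data.List.Membership.Propositional.Properties using (∈-map⁻; ∈-concatMap⁻)
open import Data.List.Relation.Unary.Any using (here; there)
open import Data.List.Relation.Unary.All as All using (All; []; _∷_)
open import Data.List.Relation.Unary.AllPairs as AllPairs using (AllPairs; []; _∷_)
open import Data.List.Relation.Unary.AllPairs.Properties using (applyUpTo⁺₁) renaming (map⁺ to allPairs-map⁺)
open import Data.List.Relation.Unary.Linked using (Linked; []; [-]; _∷_)
open import Data.List.Relation.Unary.Linked.Properties using (AllPairs⇒Linked)
open import Data.List.Relation.Binary.Permutation.Propositional using (_↭_; ↭-refl; ↭-prep; ↭-swap; ↭-trans; ↭-sym; ↭⇒↭ₛ)
open import Data.List.Relation.Binary.Permutation.Propositional.Properties using (All-resp-↭; ↭-length)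
import Data.List.Relation.Binary.Permutation.Setoid.Properties as PermutationSetoid
open import Data.Product using (_×_; _,_; proj₁; proj₂; ∃-syntax)
open import Data.Sum using (_⊎_; inj₁; inj₂)
open import Data.Empty using (⊥-elim)
open import Function using (_∘_; id; _⇔_; mk⇔; Equivalence)
open import Relation.Binary.Definitions using (tri<; tri≈; tri>)
open import Relation.Binary.PropositionalEquality

<⇒<ᵇ≡true : ∀ {x y} → x < y → (x <ᵇ y) ≡ true
<⇒<ᵇ≡true {zero}  {suc y} _       = refl
<⇒<ᵇ≡true {suc x} {suc y} (s≤s p) = <⇒<ᵇ≡true p

≤⇒<ᵇ≡false : ∀ {x y} → y ≤ x → (x <ᵇ y) ≡ false
≤⇒<ᵇ≡false {x}     {zero}  _       = refl
≤⇒<ᵇ≡false {suc x} {suc y} (s≤s p) = ≤⇒<ᵇ≡false p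

∧-true : ∀ a {b} → a ∧ b ≡ true → a ≡ true × b ≡ true
∧-true true refl = refl , refl

∧-false : ∀ a {b} → a ∧ b ≡ false → a ≡ false ⊎ b ≡ false
∧-false false _ = inj₁ refl
∧-false true  e = inj₂ e

∧-false-right : ∀ a {b} → a ≡ true → a ∧ b ≡ false → b ≡ false
∧-false-right true refl e = e

xor-as-∨ : ∀ a b → (a ∧ not b) ∨ (not a ∧ b) ≡ a xor b
xor-as-∨ true  true  = refl
xor-as-∨ true  false = refl
xor-as-∨ false true  = refl
xor-as-∨ false false = refl

xor-cancelˡ : ∀ a {b c} → a xor b ≡ a xor c → b ≡ c
xor-cancelˡ true  = not-injective
xor-cancelˡ false = id

<⇒≡ᵇ≡false : ∀ {x y} → y < x → (x ≡ᵇ y) ≡ false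
<⇒≡ᵇ≡false {suc x} {zero}  _       = refl
<⇒≡ᵇ≡false {suc x} {suc y} (s≤s p) = <⇒≡ᵇ≡false p

<ᵇ-flip : ∀ {x y} → x ≢ y → (y <ᵇ x) ≡ not (x <ᵇ y)
<ᵇ-flip {x} {y} x≢y with <-cmp x y
... | tri< x<y _ _ rewrite <⇒<ᵇ≡true x<y | ≤⇒<ᵇ≡false (<⇒≤ x<y) = refl
... | tri≈ _ x≡y _ = ⊥-elim (x≢y x≡y)
... | tri> _ _ y<x rewrite <⇒<ᵇ≡true y<x | ≤⇒<ᵇ≡false (<⇒≤ y<x) = refl

sum-map-concatMap : ∀ {A B : Set} (g : B → ℕ) (f : A → List B) (L : List A) →
  sum (map g (concatMap f L)) ≡ sum (map (λ a → sum (map g (f a))) L)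
sum-map-concatMap g f []      = refl
sum-map-concatMap g f (a ∷ L) = begin
  sum (map g (f a ++ concatMap f L))               ≡⟨ cong sum (map-++ g (f a) (concatMap f L)) ⟩
  sum (map g (f a) ++ map g (concatMap f L))       ≡⟨ sum-++ (map g (f a)) _ ⟩
  sum (map g (f a)) + sum (map g (concatMap f L))  ≡⟨ cong (sum (map g (f a)) +_) (sum-map-concatMap g f L) ⟩
  sum (map g (f a)) + sum (map (λ a → sum (map g (f a))) L) ∎
  where open ≡-Reasoning

sum-map-+ : ∀ {A : Set} (f g : A → ℕ) (L : List A) →
  sum (map (λ a → f a + g a) L) ≡ sum (map f L) + sum (map g L)
sum-map-+ f g []      = refl
sum-map-+ f g (a ∷ L) = trans (cong (f a + g a +_) (sum-map-+ f g L)) (interchange (f a) (g a) _ _)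

insertions-↭ : ∀ x ys {τ} → τ ∈ insertions x ys → τ ↭ x ∷ ys
insertions-↭ x []       (here refl) = ↭-refl
insertions-↭ x []       (there ())
insertions-↭ x (y ∷ ys) (here refl) = ↭-refl
insertions-↭ x (y ∷ ys) (there τ∈) with ∈-map⁻ (y ∷_) τ∈
... | τ′ , τ′∈ , refl = ↭-trans (↭-prep y (insertions-↭ x ys τ′∈)) (↭-swap y x ↭-refl)

perms-↭ : ∀ xs {σ} → σ ∈ perms xs → σ ↭ xs
perms-↭ []       (here refl) = ↭-refl
perms-↭ []       (there ())
perms-↭ (x ∷ xs) τ∈ with find (∈-concatMap⁻ (insertions x) τ∈)
... | σ , σ∈ , τ∈′ = ↭-trans (insertions-↭ x σ τ∈′) (↭-prep x (perms-↭ xs σ∈))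

oneTo-sorted : ∀ n → AllPairs _<_ (oneTo n)
oneTo-sorted n = allPairs-map⁺ (applyUpTo⁺₁ (λ i → i) n (λ i<j _ → s≤s i<j))

oneTo-length : ∀ n → length (oneTo n) ≡ n
oneTo-length n = trans (length-map suc (upTo n)) (length-upTo n)

Perms-length : ∀ n {π} → π ∈ Perms n → length π ≡ n
Perms-length n π∈ = trans (↭-length (perms-↭ (oneTo n) π∈)) (oneTo-length n)

Perms-adjacent-distinct : ∀ n {π} → π ∈ Perms n → Linked _≢_ π
Perms-adjacent-distinct n π∈ = AllPairs⇒Linked
  (PermutationSetoid.Unique-resp-↭ (setoid ℕ) (↭⇒↭ₛ (↭-sym (perms-↭ (oneTo n) π∈)))
    (AllPairs.map <⇒≢ (oneTo-sorted n)))

updown : List ℕ → List Bool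
updown []           = []
updown (x ∷ [])     = []
updown (x ∷ y ∷ ys) = (x <ᵇ y) ∷ updown (y ∷ ys)

-- The words of the permutations obtained by inserting a new minimum into a permutation
-- with word w: `insertMin w` lists them for the insertion positions from left to right
-- (in front, the minimum creates an ascent); `insertMinAfterFirst w` omits the front.
insertMinAfterFirst : List Bool → List (List Bool)
insertMinAfterFirst []      = (false ∷ []) ∷ []
insertMinAfterFirst (c ∷ w) = (false ∷ true ∷ w) ∷ map (c ∷_) (insertMinAfterFirst w)

insertMin : List Bool → List (List Bool)
insertMin w = (true ∷ w) ∷ insertMinAfterFirst w

updown-prefix : ∀ y z (L : List (List ℕ)) →
  map updown (map (y ∷_) (map (z ∷_) L)) ≡ map ((y <ᵇ z) ∷_) (map updown (map (z ∷_) L))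
updown-prefix y z []      = refl
updown-prefix y z (τ ∷ L) = cong (_ ∷_) (updown-prefix y z L)

updown-insertions-after : ∀ x y ys → x < y → All (x <_) ys →
  map updown (map (y ∷_) (insertions x ys)) ≡ insertMinAfterFirst (updown (y ∷ ys))
updown-insertions-after x y []       x<y []            rewrite ≤⇒<ᵇ≡false (<⇒≤ x<y) = refl
updown-insertions-after x y (z ∷ zs) x<y (x<z ∷ x<zs) rewrite ≤⇒<ᵇ≡false (<⇒≤ x<y) | <⇒<ᵇ≡true x<z =
  cong (_ ∷_) (trans (updown-prefix y z (insertions x zs))
                     (cong (map ((y <ᵇ z) ∷_)) (updown-insertions-after x z zs x<z x<zs)))

updown-insertions : ∀ x y ys → All (x <_) (y ∷ ys) →
  map updown (insertions x (y ∷ ys)) ≡ insertMin (updown (y ∷ ys))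
updown-insertions x y ys (x<y ∷ x<ys) rewrite <⇒<ᵇ≡true x<y =
  cong (_ ∷_) (updown-insertions-after x y ys x<y x<ys)

weight : (List Bool → ℕ) → List ℕ → ℕ
weight h xs = sum (map (h ∘ updown) (perms xs))

weight-cong : ∀ {h h′} xs → (∀ w → h w ≡ h′ w) → weight h xs ≡ weight h′ xs
weight-cong xs h≗h′ = cong sum (map-cong (h≗h′ ∘ updown) (perms xs))

weight-+ : ∀ h₁ h₂ xs → weight (λ w → h₁ w + h₂ w) xs ≡ weight h₁ xs + weight h₂ xs
weight-+ h₁ h₂ xs = sum-map-+ (h₁ ∘ updown) (h₂ ∘ updown) (perms xs)

-- Removing the minimum x: each permutation of x ∷ xs arises from exactly one permutation
-- σ of xs by inserting x, and the words so produced are `insertMin (updown σ)`.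
weight-insertMin : ∀ h x y ys → All (x <_) (y ∷ ys) →
  weight h (x ∷ y ∷ ys) ≡ weight (λ w → sum (map h (insertMin w))) (y ∷ ys)
weight-insertMin h x y ys x<xs =
  trans (sum-map-concatMap (h ∘ updown) (insertions x) (perms (y ∷ ys)))
        (cong sum (map-cong-local (All.tabulate insert-into)))
  where
  insert-into : ∀ {σ} → σ ∈ perms (y ∷ ys) →
    sum (map (h ∘ updown) (insertions x σ)) ≡ sum (map h (insertMin (updown σ)))
  insert-into {[]} σ∈ with () ← ↭-length (perms-↭ (y ∷ ys) σ∈)
  insert-into {z ∷ zs} σ∈ = trans (cong sum (map-∘ (insertions x (z ∷ zs))))
    (cong (sum ∘ map h) (updown-insertions x z zs (All-resp-↭ (↭-sym (perms-↭ (y ∷ ys) σ∈)) x<xs)))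

indicator : List Bool → List Bool → ℕ
indicator []          []          = 1
indicator (true ∷ t)  (true ∷ w)  = indicator t w
indicator (false ∷ t) (false ∷ w) = indicator t w
indicator _           _           = 0

indicator-self : ∀ t → indicator t t ≡ 1
indicator-self []          = refl
indicator-self (true ∷ t)  = indicator-self t
indicator-self (false ∷ t) = indicator-self t

indicator-≢ : ∀ t w → w ≢ t → indicator t w ≡ 0
indicator-≢ []          []          w≢t = ⊥-elim (w≢t refl)
indicator-≢ []          (_ ∷ _)     _   = refl
indicator-≢ (true ∷ t)  []          _   = refl
indicator-≢ (false ∷ t) []          _   = refl
indicator-≢ (true ∷ t)  (true ∷ w)  w≢t = indicator-≢ t w (w≢t ∘ cong (true ∷_))
indicator-≢ (true ∷ t)  (false ∷ w) _   = refl
indicator-≢ (false ∷ t) (true ∷ w)  _   = refl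
indicator-≢ (false ∷ t) (false ∷ w) w≢t = indicator-≢ t w (w≢t ∘ cong (false ∷_))

countWord : List Bool → List ℕ → ℕ
countWord t = weight (indicator t)

ways : List Bool → List Bool → ℕ
ways t w = sum (map (indicator t) (insertMin w))

afterFirst : (List Bool → ℕ) → List Bool → ℕ
afterFirst h w = sum (map h (insertMinAfterFirst w))

afterFirst-cons : ∀ h c w → afterFirst h (c ∷ w) ≡ h (false ∷ true ∷ w) + afterFirst (h ∘ (c ∷_)) w
afterFirst-cons h c w = cong (h (false ∷ true ∷ w) +_) (cong sum (sym (map-∘ (insertMinAfterFirst w))))

afterFirst-zero : ∀ w → afterFirst (λ _ → 0) w ≡ 0
afterFirst-zero []      = refl
afterFirst-zero (c ∷ w) = trans (afterFirst-cons (λ _ → 0) c w) (afterFirst-zero w)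

-- D^a U^b: a descents followed by b ascents.
valley : ℕ → ℕ → List Bool
valley zero    b = replicate b true
valley (suc a) b = false ∷ valley a b

-- Inserting the minimum after the first entry creates a descent: no all-ascent word arises.
afterFirst-ascents : ∀ b w → afterFirst (indicator (valley 0 b)) w ≡ 0
afterFirst-ascents zero    []          = refl
afterFirst-ascents (suc b) []          = refl
afterFirst-ascents zero    (c ∷ w)     = trans (afterFirst-cons (indicator []) c w) (afterFirst-zero w)
afterFirst-ascents (suc b) (true ∷ w)  =
  trans (afterFirst-cons (indicator (valley 0 (suc b))) true w) (afterFirst-ascents b w)
afterFirst-ascents (suc b) (false ∷ w) =
  trans (afterFirst-cons (indicator (valley 0 (suc b))) false w) (afterFirst-zero w)

-- The minimum of U^(b+1) is its first entry; removing it leaves U^b.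
ways-ascents : ∀ b w → ways (valley 0 (suc b)) w ≡ indicator (valley 0 b) w
ways-ascents b w = trans (cong (indicator (valley 0 b) w +_) (afterFirst-ascents (suc b) w)) (+-identityʳ _)

-- The minimum of a word D^(a+1) U^b sits at its valley, never in front; removing it
-- leaves D^a U^b or, when b > 0, D^(a+1) U^(b-1) (according as its neighbours compare).
ways-descents : ∀ a w → ways (valley (suc a) 0) w ≡ indicator (valley a 0) w
ways-descents a       []          = +-identityʳ _
ways-descents a       (true ∷ w)  = trans (afterFirst-cons (indicator (valley (suc a) 0)) true w)
  (trans (cong (indicator (valley a 0) (true ∷ w) +_) (afterFirst-zero w)) (+-identityʳ _))
ways-descents zero    (false ∷ w) =
  trans (afterFirst-cons (indicator (valley 1 0)) false w) (afterFirst-ascents 0 w)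
ways-descents (suc a) (false ∷ w) =
  trans (afterFirst-cons (indicator (valley (suc (suc a)) 0)) false w) (ways-descents a w)

ways-valley : ∀ a b w → ways (valley (suc a) (suc b)) w ≡
  indicator (valley (suc a) b) w + indicator (valley a (suc b)) w
ways-valley a       b []          = +-identityʳ _
ways-valley a       b (true ∷ w)  = trans (afterFirst-cons (indicator (valley (suc a) (suc b))) true w)
  (trans (cong (indicator (valley a (suc b)) (true ∷ w) +_) (afterFirst-zero w)) (+-identityʳ _))
ways-valley zero    b (false ∷ w) = trans (afterFirst-cons (indicator (valley 1 (suc b))) false w)
  (cong (indicator (valley 0 b) w +_) (afterFirst-ascents (suc b) w))
ways-valley (suc a) b (false ∷ w) =
  trans (afterFirst-cons (indicator (valley (suc (suc a)) (suc b))) false w) (ways-valley a b w)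

-- For a word U·t the inserted minimum is either the first entry (leaving t) or comes after
-- the first entry of a word that starts with an ascent.
afterFirst-peak-descents : ∀ a w →
  afterFirst (indicator (true ∷ valley (suc a) 0)) w ≡ indicator (true ∷ valley a 0) w
afterFirst-peak-descents a []          = refl
afterFirst-peak-descents a (true ∷ w)  =
  trans (afterFirst-cons (indicator (true ∷ valley (suc a) 0)) true w) (ways-descents a w)
afterFirst-peak-descents a (false ∷ w) =
  trans (afterFirst-cons (indicator (true ∷ valley (suc a) 0)) false w) (afterFirst-zero w)

afterFirst-peak-valley : ∀ a b w → afterFirst (indicator (true ∷ valley (suc a) (suc b))) w ≡
  indicator (true ∷ valley (suc a) b) w + indicator (true ∷ valley a (suc b)) w
afterFirst-peak-valley a b []          = refl
afterFirst-peak-valley a b (true ∷ w)  =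
  trans (afterFirst-cons (indicator (true ∷ valley (suc a) (suc b))) true w) (ways-valley a b w)
afterFirst-peak-valley a b (false ∷ w) =
  trans (afterFirst-cons (indicator (true ∷ valley (suc a) (suc b))) false w) (afterFirst-zero w)

-- The minimum of U D^(a+1) U^b is its first entry or sits at its valley.
ways-peak-descents : ∀ a w → ways (true ∷ valley (suc a) 0) w ≡
  indicator (valley (suc a) 0) w + indicator (true ∷ valley a 0) w
ways-peak-descents a w = cong (indicator (valley (suc a) 0) w +_) (afterFirst-peak-descents a w)

ways-peak-valley : ∀ a b w → ways (true ∷ valley (suc a) (suc b)) w ≡
  indicator (valley (suc a) (suc b)) w + (indicator (true ∷ valley (suc a) b) w + indicator (true ∷ valley a (suc b)) w)
ways-peak-valley a b w = cong (indicator (valley (suc a) (suc b)) w +_) (afterFirst-peak-valley a b w)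

countWord-insertMin : ∀ t x y ys → All (x <_) (y ∷ ys) → countWord t (x ∷ y ∷ ys) ≡ weight (ways t) (y ∷ ys)
countWord-insertMin t = weight-insertMin (indicator t)

descents-count : ∀ a → (a + 0) C a ≡ 1
descents-count a = trans (cong (_C a) (+-identityʳ a)) (nCn≡1 a)

pascal : ∀ a b → (suc a + b) C suc a + (a + suc b) C a ≡ (suc a + suc b) C suc a
pascal a b = begin
  (suc a + b) C suc a + n C a  ≡⟨ cong (λ k → k C suc a + n C a) (sym (+-suc a b)) ⟩
  n C suc a + n C a            ≡⟨ +-comm (n C suc a) (n C a) ⟩
  n C a + n C suc a            ≡⟨ nCk+nC[k+1]≡[n+1]C[k+1] n a ⟩
  suc n C suc a                ∎
  where
  open ≡-Reasoning
  n = a + suc b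

-- #D^a U^b = C(a+b, a): the entries left of the minimum form an arbitrary a-subset.
countValley : ∀ a b xs → AllPairs _<_ xs → length xs ≡ suc (a + b) → countWord (valley a b) xs ≡ (a + b) C a
countValley zero    zero    (x ∷ [])     _                  _   = refl
countValley zero    (suc b) (x ∷ y ∷ ys) (x<ys ∷ ys-sorted) len = begin
  countWord (valley 0 (suc b)) (x ∷ y ∷ ys)  ≡⟨ countWord-insertMin (valley 0 (suc b)) x y ys x<ys ⟩
  weight (ways (valley 0 (suc b))) (y ∷ ys)  ≡⟨ weight-cong (y ∷ ys) (ways-ascents b) ⟩
  countWord (valley 0 b) (y ∷ ys)            ≡⟨ countValley 0 b (y ∷ ys) ys-sorted (suc-injective len) ⟩
  1                                          ∎
  where open ≡-Reasoning
countValley (suc a) zero    (x ∷ y ∷ ys) (x<ys ∷ ys-sorted) len = begin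
  countWord (valley (suc a) 0) (x ∷ y ∷ ys)  ≡⟨ countWord-insertMin (valley (suc a) 0) x y ys x<ys ⟩
  weight (ways (valley (suc a) 0)) (y ∷ ys)  ≡⟨ weight-cong (y ∷ ys) (ways-descents a) ⟩
  countWord (valley a 0) (y ∷ ys)            ≡⟨ countValley a 0 (y ∷ ys) ys-sorted (suc-injective len) ⟩
  (a + 0) C a                                ≡⟨ trans (descents-count a) (sym (descents-count (suc a))) ⟩
  (suc a + 0) C suc a                        ∎
  where open ≡-Reasoning
countValley (suc a) (suc b) (x ∷ y ∷ ys) (x<ys ∷ ys-sorted) len = begin
  countWord (valley (suc a) (suc b)) (x ∷ y ∷ ys)
    ≡⟨ countWord-insertMin (valley (suc a) (suc b)) x y ys x<ys ⟩
  weight (ways (valley (suc a) (suc b))) (y ∷ ys)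
    ≡⟨ weight-cong (y ∷ ys) (ways-valley a b) ⟩
  weight (λ w → indicator (valley (suc a) b) w + indicator (valley a (suc b)) w) (y ∷ ys)
    ≡⟨ weight-+ (indicator (valley (suc a) b)) (indicator (valley a (suc b))) (y ∷ ys) ⟩
  countWord (valley (suc a) b) (y ∷ ys) + countWord (valley a (suc b)) (y ∷ ys)
    ≡⟨ cong₂ _+_ (countValley (suc a) b (y ∷ ys) ys-sorted (trans len′ (cong suc (+-suc a b))))
                 (countValley a (suc b) (y ∷ ys) ys-sorted len′) ⟩
  (suc a + b) C suc a + (a + suc b) C a
    ≡⟨ pascal a b ⟩
  (suc a + suc b) C suc a ∎
  where
  open ≡-Reasoning
  len′ : length (y ∷ ys) ≡ suc (a + suc b)
  len′ = suc-injective len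

peakValleyNumber : ℕ → ℕ → ℕ
peakValleyNumber a b = (a + b) C a + a * (suc (a + b) C suc a)

peakValleyNumber-descents : ∀ a → peakValleyNumber (suc a) 0 ≡ (suc a + 0) C suc a + peakValleyNumber a 0
peakValleyNumber-descents a
  rewrite descents-count a | descents-count (suc a) | descents-count (suc (suc a)) = refl

peakValleyNumber-step : ∀ a b → peakValleyNumber (suc a) (suc b) ≡
  (suc a + suc b) C suc a + (peakValleyNumber (suc a) b + peakValleyNumber a (suc b))
peakValleyNumber-step a b = begin
  peakValleyNumber (suc a) (suc b)
    ≡⟨ cong (λ X → suc n C suc a + suc a * X) (nCk+nC[k+1]≡[n+1]C[k+1] (suc n) (suc a)) ⟨
  suc n C suc a + suc a * (suc n C suc a + V)
    ≡⟨ cong (λ X → X + suc a * (X + V)) pascal-n ⟨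
  (Y + Z) + suc a * ((Y + Z) + V)
    ≡⟨ solve 4 (λ a Y Z V → (Y :+ Z) :+ (con 1 :+ a) :* ((Y :+ Z) :+ V)
                          := (Y :+ Z) :+ ((Z :+ (con 1 :+ a) :* V) :+ (Y :+ a :* (Y :+ Z))))
             refl a Y Z V ⟩
  (Y + Z) + ((Z + suc a * V) + (Y + a * (Y + Z)))
    ≡⟨ cong (λ X → X + ((Z + suc a * V) + (Y + a * X))) pascal-n ⟩
  suc n C suc a + ((n C suc a + suc a * V) + (n C a + a * (suc n C suc a)))
    ≡⟨ cong (λ k → suc n C suc a + ((k C suc a + suc a * (suc k C suc (suc a))) + peakValleyNumber a (suc b)))
            (+-suc a b) ⟩
  (suc a + suc b) C suc a + (peakValleyNumber (suc a) b + peakValleyNumber a (suc b)) ∎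
  where
  open ≡-Reasoning
  open +-*-Solver
  n = a + suc b
  Y = n C a
  Z = n C suc a
  V = suc n C suc (suc a)
  pascal-n : Y + Z ≡ suc n C suc a
  pascal-n = nCk+nC[k+1]≡[n+1]C[k+1] n a

countPeakValley : ∀ a b xs → AllPairs _<_ xs → length xs ≡ suc (suc (a + b)) →
  countWord (true ∷ valley a b) xs ≡ peakValleyNumber a b
countPeakValley zero    b       xs           xs-sorted          len = countValley 0 (suc b) xs xs-sorted len
countPeakValley (suc a) zero    (x ∷ y ∷ ys) (x<ys ∷ ys-sorted) len = begin
  countWord (true ∷ valley (suc a) 0) (x ∷ y ∷ ys)
    ≡⟨ countWord-insertMin (true ∷ valley (suc a) 0) x y ys x<ys ⟩
  weight (ways (true ∷ valley (suc a) 0)) (y ∷ ys)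
    ≡⟨ weight-cong (y ∷ ys) (ways-peak-descents a) ⟩
  weight (λ w → indicator (valley (suc a) 0) w + indicator (true ∷ valley a 0) w) (y ∷ ys)
    ≡⟨ weight-+ (indicator (valley (suc a) 0)) (indicator (true ∷ valley a 0)) (y ∷ ys) ⟩
  countWord (valley (suc a) 0) (y ∷ ys) + countWord (true ∷ valley a 0) (y ∷ ys)
    ≡⟨ cong₂ _+_ (countValley (suc a) 0 (y ∷ ys) ys-sorted (suc-injective len))
                 (countPeakValley a 0 (y ∷ ys) ys-sorted (suc-injective len)) ⟩
  (suc a + 0) C suc a + peakValleyNumber a 0
    ≡⟨ peakValleyNumber-descents a ⟨
  peakValleyNumber (suc a) 0 ∎
  where open ≡-Reasoning
countPeakValley (suc a) (suc b) (x ∷ y ∷ ys) (x<ys ∷ ys-sorted) len = begin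
  countWord (true ∷ valley (suc a) (suc b)) (x ∷ y ∷ ys)
    ≡⟨ countWord-insertMin (true ∷ valley (suc a) (suc b)) x y ys x<ys ⟩
  weight (ways (true ∷ valley (suc a) (suc b))) (y ∷ ys)
    ≡⟨ weight-cong (y ∷ ys) (ways-peak-valley a b) ⟩
  weight (λ w → indicator t₀ w + (indicator t₁ w + indicator t₂ w)) (y ∷ ys)
    ≡⟨ weight-+ (indicator t₀) (λ w → indicator t₁ w + indicator t₂ w) (y ∷ ys) ⟩
  countWord t₀ (y ∷ ys) + weight (λ w → indicator t₁ w + indicator t₂ w) (y ∷ ys)
    ≡⟨ cong (countWord t₀ (y ∷ ys) +_) (weight-+ (indicator t₁) (indicator t₂) (y ∷ ys)) ⟩
  countWord t₀ (y ∷ ys) + (countWord t₁ (y ∷ ys) + countWord t₂ (y ∷ ys))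
    ≡⟨ cong₂ _+_ (countValley (suc a) (suc b) (y ∷ ys) ys-sorted len′)
         (cong₂ _+_ (countPeakValley (suc a) b (y ∷ ys) ys-sorted (trans len′ (cong (suc ∘ suc) (+-suc a b))))
                    (countPeakValley a (suc b) (y ∷ ys) ys-sorted len′)) ⟩
  (suc a + suc b) C suc a + (peakValleyNumber (suc a) b + peakValleyNumber a (suc b))
    ≡⟨ peakValleyNumber-step a b ⟨
  peakValleyNumber (suc a) (suc b) ∎
  where
  open ≡-Reasoning
  t₀ = valley (suc a) (suc b)
  t₁ = true ∷ valley (suc a) b
  t₂ = true ∷ valley a (suc b)
  len′ : length (y ∷ ys) ≡ suc (suc (a + suc b))
  len′ = suc-injective len

-- The k-th letter of a word (counting from 0; false past the end), and whether the word
-- changes letter between positions j and j+1.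
letter : List Bool → ℕ → Bool
letter []      _       = false
letter (c ∷ w) zero    = c
letter (c ∷ w) (suc k) = letter w k

change : List Bool → ℕ → Bool
change w j = letter w j xor letter w (suc j)

word-determined : ∀ w v → length w ≡ length v → letter w 0 ≡ letter v 0 →
  (∀ j → suc j < length w → change w j ≡ change v j) → w ≡ v
word-determined []                []                _   _   _       = refl
word-determined (c ∷ [])          (d ∷ [])          _   c≡d _       = cong (_∷ []) c≡d
word-determined (c ∷ w@(_ ∷ _))   (d ∷ v@(_ ∷ _))   len c≡d changes =
  cong₂ _∷_ c≡d (word-determined w v (suc-injective len) second-letter
                   (λ j j+1<w → changes (suc j) (s≤s j+1<w)))
  where
  second-letter : letter w 0 ≡ letter v 0
  second-letter = xor-cancelˡ c (trans (changes 0 (s≤s (s≤s z≤n))) (cong (_xor letter v 0) (sym c≡d)))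

updown-length : ∀ x xs → length (updown (x ∷ xs)) ≡ length xs
updown-length x []       = refl
updown-length x (y ∷ ys) = cong suc (updown-length y ys)

-- The letters of the up-down word compare consecutive entries (in both directions,
-- as adjacent entries differ).
updown-letter : ∀ π k → Linked _≢_ π → suc (suc k) ≤ length π →
  (entry π (suc k) <ᵇ entry π (suc (suc k))) ≡ letter (updown π) k ×
  (entry π (suc (suc k)) <ᵇ entry π (suc k)) ≡ not (letter (updown π) k)
updown-letter (x ∷ [])     k       [-]       (s≤s ())
updown-letter (x ∷ y ∷ ys) zero    (x≢y ∷ _) _          = refl , <ᵇ-flip x≢y
updown-letter (x ∷ y ∷ ys) (suc k) (_ ∷ adj) (s≤s k+2≤) = updown-letter (y ∷ ys) k adj k+2≤

isPV-inside : ∀ π j → Linked _≢_ π → suc (suc j) < length π →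
  isPV π (suc (suc j)) ≡ change (updown π) j
isPV-inside π j adj j+2<n =
  trans (cong (λ inside → (inside ∧ (E₁ <ᵇ E₂) ∧ (E₃ <ᵇ E₂)) ∨ (inside ∧ (E₂ <ᵇ E₁) ∧ (E₂ <ᵇ E₃)))
              (<⇒<ᵇ≡true j+2<n))
  (trans (cong₂ _∨_ (cong₂ _∧_ (proj₁ first) (proj₂ second)) (cong₂ _∧_ (proj₂ first) (proj₁ second)))
         (xor-as-∨ (letter (updown π) j) (letter (updown π) (suc j))))
  where
  E₁ = entry π (suc j)
  E₂ = entry π (suc (suc j))
  E₃ = entry π (suc (suc (suc j)))
  first  = updown-letter π j adj (<⇒≤ j+2<n)
  second = updown-letter π (suc j) adj j+2<n

isPV-last : ∀ π j → length π ≡ suc (suc j) → isPV π (suc (suc j)) ≡ false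
isPV-last π j n≡j+2 rewrite n≡j+2 | ≤⇒<ᵇ≡false (≤-refl {suc (suc j)}) = refl

isPeak-2 : ∀ π → Linked _≢_ π → 2 < length π → isPeak π 2 ≡ letter (updown π) 0 ∧ not (letter (updown π) 1)
isPeak-2 π adj 2<n =
  trans (cong (_∧ ((entry π 1 <ᵇ entry π 2) ∧ (entry π 3 <ᵇ entry π 2))) (<⇒<ᵇ≡true 2<n))
        (cong₂ _∧_ (proj₁ (updown-letter π 0 adj (<⇒≤ 2<n))) (proj₂ (updown-letter π 1 adj 2<n)))

inTwoM : ℕ → ℕ → Bool
inTwoM m i = (i ≡ᵇ 2) ∨ (i ≡ᵇ m)

allBelow-true⇒ : ∀ {k f i} → allBelow k f ≡ true → i < k → f i ≡ true
allBelow-true⇒ {suc k} all (s≤s i≤k) with ∧-true _ all | m≤n⇒m<n∨m≡n i≤k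
... | below , _    | inj₁ i<k  = allBelow-true⇒ below i<k
... | _     , last | inj₂ refl = last

allBelow-false⇒ : ∀ {k f} → allBelow k f ≡ false → ∃[ i ] i < k × f i ≡ false
allBelow-false⇒ {suc k} {f} some with ∧-false (allBelow k f) some
... | inj₁ below = let i , i<k , fi = allBelow-false⇒ below in i , m<n⇒m<1+n i<k , fi
... | inj₂ last  = k , ≤-refl , last

inPV2m⇒ : ∀ m π → inPV2m m π ≡ true →
  isPeak π 2 ≡ true × (∀ i → i ≤ length π → isPV π i ≡ inTwoM m i)
inPV2m⇒ m π member = proj₁ (∧-true (isPeak π 2) member) , agree
  where
  agree : ∀ i → i ≤ length π → isPV π i ≡ inTwoM m i
  agree i i≤n with allBelow-true⇒ {i = i} (proj₂ (∧-true (isPeak π 2) member)) (s≤s i≤n)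
  ... | agreement with isPV π i
  ...   | true  = sym agreement
  ...   | false = sym (not-injective agreement)

inPV2m⇐ : ∀ m π → isPeak π 2 ≡ true → (∀ i → i ≤ length π → isPV π i ≡ inTwoM m i) →
  inPV2m m π ≡ true
inPV2m⇐ m π peak agree with inPV2m m π in member
... | true  = refl
... | false with allBelow-false⇒ (∧-false-right (isPeak π 2) peak member)
...   | i , i<n+1 , disagreement with isPV π i | agree i (s≤s⁻¹ i<n+1)
...     | true  | pv with () ← trans pv disagreement
...     | false | pv with () ← trans (cong not pv) disagreement

-- The condition PV(π) = {2, m} with 2 a peak, read off the up-down word w of π: w starts
-- with an ascent and changes letter between positions j and j+1 exactly when j+2 ∈ {2, m}.
Shape : ℕ → List Bool → Set
Shape m w = letter w 0 ≡ true × (∀ j → suc j < length w → change w j ≡ inTwoM m (suc (suc j)))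

member⇒shape : ∀ m π → Linked _≢_ π → 3 ≤ m → m < length π → inPV2m m π ≡ true → Shape m (updown π)
member⇒shape m (x ∷ xs) adj 3≤m m<n member =
  proj₁ (∧-true (letter w 0) (trans (sym (isPeak-2 π adj 2<n)) peak)) , changes
  where
  π = x ∷ xs
  w = updown π
  peak  = proj₁ (inPV2m⇒ m π member)
  agree = proj₂ (inPV2m⇒ m π member)
  2<n : 2 < length π
  2<n = ≤-trans 3≤m (<⇒≤ m<n)
  changes : ∀ j → suc j < length w → change w j ≡ inTwoM m (suc (suc j))
  changes j j+1<w = trans (sym (isPV-inside π j adj j+2<n)) (agree (suc (suc j)) (<⇒≤ j+2<n))
    where
    j+2<n : suc (suc j) < length π
    j+2<n = s≤s (subst (suc j <_) (updown-length x xs) j+1<w)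

shape⇒member : ∀ m π → Linked _≢_ π → 3 ≤ m → m < length π → Shape m (updown π) → inPV2m m π ≡ true
shape⇒member m (x ∷ xs) adj 3≤m@(s≤s (s≤s (s≤s _))) m<n (first , changes) = inPV2m⇐ m π peak agree
  where
  π = x ∷ xs
  w = updown π
  1<w : 1 < length w
  1<w = subst (1 <_) (sym (updown-length x xs)) (s≤s⁻¹ (≤-trans 3≤m (<⇒≤ m<n)))
  peak : isPeak π 2 ≡ true
  peak = trans (isPeak-2 π adj (≤-trans 3≤m (<⇒≤ m<n)))
               (cong₂ _∧_ first (trans (cong (_xor letter w 1) (sym first)) (changes 0 1<w)))
  agree : ∀ i → i ≤ length π → isPV π i ≡ inTwoM m i
  agree zero          _   = refl
  agree (suc zero)    _   = refl
  agree (suc (suc j)) i≤n with m≤n⇒m<n∨m≡n i≤n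
  ... | inj₁ j+2<n = trans (isPV-inside π j adj j+2<n)
                           (changes j (subst (suc j <_) (sym (updown-length x xs)) (s≤s⁻¹ j+2<n)))
  ... | inj₂ j+2≡n = trans (isPV-last π j (sym j+2≡n))
                           (sym (cong₂ _∨_ (<⇒≡ᵇ≡false (≤-trans 3≤m (<⇒≤ m<j+2)))
                                           (<⇒≡ᵇ≡false m<j+2)))
    where
    m<j+2 : m < suc (suc j)
    m<j+2 = subst (m <_) (sym j+2≡n) m<n

valley-length : ∀ a b → length (valley a b) ≡ a + b
valley-length zero    b = length-replicate b
valley-length (suc a) b = cong suc (valley-length a b)

ascents-letter : ∀ b k → k < length (replicate b true) → letter (replicate b true) k ≡ true
ascents-letter (suc b) zero    _          = refl
ascents-letter (suc b) (suc k) (s≤s k<b) = ascents-letter b k k<b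

valley-change : ∀ a b j → suc j < length (valley a b) → change (valley a b) j ≡ (suc j ≡ᵇ a)
valley-change zero          b j       j+1<w =
  cong₂ _xor_ (ascents-letter b j (<-trans (n<1+n j) j+1<w)) (ascents-letter b (suc j) j+1<w)
valley-change (suc zero)    b zero    j+1<w = ascents-letter b 0 (s≤s⁻¹ j+1<w)
valley-change (suc (suc a)) b zero    _     = refl
valley-change (suc a)       b (suc j) j+1<w = valley-change a b j (s≤s⁻¹ j+1<w)

target-shape : ∀ a b → Shape (suc (suc (suc a))) (true ∷ valley (suc a) b)
target-shape a b = refl , changes
  where
  changes : ∀ j → suc j < length (true ∷ valley (suc a) b) →
    change (true ∷ valley (suc a) b) j ≡ inTwoM (suc (suc (suc a))) (suc (suc j))
  changes zero    _     = refl
  changes (suc j) j+2<w = valley-change (suc a) b j (s≤s⁻¹ j+2<w)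

shape-unique : ∀ m w v → Shape m w → Shape m v → length w ≡ length v → w ≡ v
shape-unique m w v (w-first , w-changes) (v-first , v-changes) len =
  word-determined w v len (trans w-first (sym v-first))
    (λ j j+1<w → trans (w-changes j j+1<w) (sym (v-changes j (subst (suc j <_) len j+1<w))))

member⇔target : ∀ a b π → Linked _≢_ π → length π ≡ suc (suc (suc a)) + suc b →
  inPV2m (suc (suc (suc a))) π ≡ true ⇔ updown π ≡ true ∷ valley (suc a) (suc b)
member⇔target a b (x ∷ xs) adj len = mk⇔
  (λ member → shape-unique m (updown π) target
                (member⇒shape m π adj 3≤m m<n member) (target-shape a (suc b)) same-length)
  (λ π-word → shape⇒member m π adj 3≤m m<n (subst (Shape m) (sym π-word) (target-shape a (suc b))))
  where
  m = suc (suc (suc a))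
  π = x ∷ xs
  target = true ∷ valley (suc a) (suc b)
  3≤m : 3 ≤ m
  3≤m = s≤s (s≤s (s≤s z≤n))
  m<n : m < length π
  m<n = subst (m <_) (sym len) (m<m+n m z<s)
  same-length : length (updown π) ≡ length target
  same-length = begin
    length (updown π)                ≡⟨ updown-length x xs ⟩
    length xs                        ≡⟨ suc-injective len ⟩
    suc (suc (a + suc b))            ≡⟨ cong suc (valley-length (suc a) (suc b)) ⟨
    length target                    ∎
    where open ≡-Reasoning

length-filter : ∀ {A : Set} (f : A → Bool) (L : List A) →
  length (filter (λ a → f a ≟B true) L) ≡ sum (map (λ a → if f a then 1 else 0) L)
length-filter f []      = refl
length-filter f (a ∷ L) with f a
... | true  = cong suc (length-filter f L)
... | false = length-filter f L

test≡indicator : ∀ (b : Bool) t w → (b ≡ true ⇔ w ≡ t) → (if b then 1 else 0) ≡ indicator t w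
test≡indicator true  t w test⇔ =
  sym (trans (cong (indicator t) (Equivalence.to test⇔ refl)) (indicator-self t))
test≡indicator false t w test⇔ = sym (indicator-≢ t w never)
  where
  never : w ≢ t
  never w≡t with () ← Equivalence.from test⇔ w≡t

countPV2m-as-countWord : ∀ a b → let m = suc (suc (suc a)); n = m + suc b in
  countPV2m m n ≡ countWord (true ∷ valley (suc a) (suc b)) (oneTo n)
countPV2m-as-countWord a b =
  trans (length-filter (inPV2m m) (Perms n)) (cong sum (map-cong-local (All.tabulate member-test)))
  where
  m = suc (suc (suc a))
  n = m + suc b
  member-test : ∀ {π} → π ∈ Perms n →
    (if inPV2m m π then 1 else 0) ≡ indicator (true ∷ valley (suc a) (suc b)) (updown π)
  member-test {π} π∈ = test≡indicator (inPV2m m π) _ (updown π)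
    (member⇔target a b π (Perms-adjacent-distinct n π∈) (Perms-length n π∈))

countPV2m-closed : ∀ a b → let m = suc (suc (suc a)) in
  countPV2m m (m + suc b) ≡ peakValleyNumber (suc a) (suc b)
countPV2m-closed a b = trans (countPV2m-as-countWord a b)
  (countPeakValley (suc a) (suc b) (oneTo n) (oneTo-sorted n) (oneTo-length n))
  where n = suc (suc (suc a)) + suc b

-- Write m = a + 3 and n = m + b + 1; the right-hand side then computes to
-- peakValleyNumber (a + 1) (b + 1).
proposition7p3 : (m n : ℕ) → 3 ≤ m → m + 1 ≤ n →
    countPV2m m n ≡ (n ∸ 2) C (m ∸ 2) + (m ∸ 2) * ((n ∸ 1) C (m ∸ 1))
proposition7p3 m@(suc (suc (suc a))) n (s≤s (s≤s (s≤s z≤n))) m+1≤n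
  with b , m+1+b≡n ← m≤n⇒∃[o]m+o≡n m+1≤n
  with refl ← trans (sym (+-assoc m 1 b)) m+1+b≡n = countPV2m-closed a b
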